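{- Let $f$ be a completely reducible $n$-ary quasigroup of order $q$. \begin{enumerate} \item If $n$ is odd, then $f$ has at least $(q\cdot q!)^{\frac{n-1}{2}}$ transversals. \item If $n$ is even and the external quasigroup of at least one proper representation of $f$ has a transversal, then $f$ has at least $(q\cdot q!)^{\lfloor \frac{n-1}{2}\rfloor}$ transversals. \end{enumerate}
   Context: Let $\Sigma_q=\{0,\dots,q-1\}$. An $n$-ary quasigroup of order $q$ is a map $f:\Sigma_q^n\to\Sigma_q$ such that the equation $x_0=f(x_1,\dots,x_n)$ has a unique solution in any one of the variables $x_0,\dots,x_n$ when the other $n$ variables are fixed arbitrarily. A transversal in $f$ is a set of $q$ vectors $\alpha^i=(a^i_0,\dots,a^i_n)\in\Sigma_q^{n+1}$, $i=1,\dots,q$, such that $a^i_0=f(a^i_1,\dots,a^i_n)$ for all $i$ and $a^i_k\neq a^j_k$ for all $i\neq j$ and all $k\in\{0,\dots,n\}$. An $n$-ary quasigroup $f$ is a composition of an $(n-m)$-ary quasigroup $h$ and an $(m+1)$-ary quasigroup $g$ (all of order $q$) if there is a permutation $\sigma$ of $\{0,\dots,n\}$ such that for all $x_0,\dots,x_n\in\Sigma_q$: $f(x_1,\dots,x_n)=x_0 \iff g(x_{\sigma(0)},\dots,x_{\sigma(m)})=h(x_{\sigma(m+1)},\dots,x_{\sigma(n)})$. All binary quasigroups are completely reducible; for $n\ge 3$, an $n$-ary quasigroup is completely reducible if it is a composition of two completely reducible quasigroups each of arity at least $2$. A proper representation of an $n$-ary quasigroup $f$ consists of a permutation $\pi$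 of $\{0,\dots,n\}$, a completely reducible $(n-1)$-ary quasigroup $h_1$ and a binary quasigroup $h_2$ (all of order $q$) such that for all $x_0,\dots,x_n\in\Sigma_q$: $x_0=f(x_1,\dots,x_n)\iff h_1(x_{\pi(0)},\dots,x_{\pi(n-2)})=h_2(x_{\pi(n-1)},x_{\pi(n)})$; the binary quasigroup $h_2$ is called the external quasigroup of this proper representation. -}

module Defs where

open import Data.Nat using (ℕ; zero; suc; _+_; _*_; _^_; _≤_)
open import Data.Fin using (Fin; _↑ˡ_; _↑ʳ_)
open import Data.Fin.Permutation using (Permutation; _⟨$⟩ʳ_)
open import Data.Vec using (Vec; head; tail; _[_]≔_; tabulate; lookup)
open import Data.Product using (Σ; ∃; ∃!; _×_)
open import Data.Sum using (_⊎_)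
open import Relation.Binary.PropositionalEquality using (_≡_)
open import Function.Bundles using (_⇔_)

Op : ℕ → ℕ → Set
Op q n = Vec (Fin q) n → Fin q

Graph : ∀ {q n} → Op q n → Vec (Fin q) (suc n) → Set
Graph f x = head x ≡ f (tail x)

IsQuasigroup : ∀ {q n} → Op q n → Set
IsQuasigroup {q} {n} f =
  ∀ (k : Fin (suc n)) (x : Vec (Fin q) (suc n)) → ∃! _≡_ (λ a → Graph f (x [ k ]≔ a))

IsComposition : ∀ {q n a b} → Op q n → Op q a → Op q b → Set
IsComposition {q} {n} {a} {b} f g h =
  Σ (Permutation (a + b) (suc n)) λ σ →
    ∀ (x : Vec (Fin q) (suc n)) →
      Graph f x ⇔
      (g (tabulate λ i → lookup x (σ ⟨$⟩ʳ (i ↑ˡ b)))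
         ≡ h (tabulate λ j → lookup x (σ ⟨$⟩ʳ (a ↑ʳ j))))

data CompletelyReducible {q : ℕ} : (n : ℕ) → Op q n → Set where
  binary  : {f : Op q 2} → IsQuasigroup f → CompletelyReducible 2 f
  compose : ∀ {n a b} {f : Op q n} {g : Op q a} {h : Op q b} →
            3 ≤ n → IsQuasigroup f → 2 ≤ a → 2 ≤ b →
            CompletelyReducible a g → CompletelyReducible b h →
            IsComposition f g h → CompletelyReducible n f

-- A transversal, given as a listing α¹,…,α^q of its q vectors in Σ_q^{n+1}
-- (the transversal itself is the set {α¹,…,α^q}).
IsTransversal : ∀ {q n} → Op q n → (Fin q → Vec (Fin q) (suc n)) → Set
IsTransversal {q} {n} f α =
  (∀ i → Graph f (α i)) ×
  (∀ i j (k : Fin (suc n)) → lookup (α i) k ≡ lookup (α j) k → i ≡ j)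

HasTransversal : ∀ {q n} → Op q n → Set
HasTransversal {q} {n} f = Σ (Fin q → Vec (Fin q) (suc n)) (IsTransversal f)

SameSet : ∀ {q n} → (Fin q → Vec (Fin q) n) → (Fin q → Vec (Fin q) n) → Set
SameSet {q} {n} α β = ∀ (v : Vec (Fin q) n) → (∃ λ i → α i ≡ v) ⇔ (∃ λ j → β j ≡ v)

AtLeastTransversals : ∀ {q n} → Op q n → ℕ → Set
AtLeastTransversals {q} {n} f N =
  Σ (Fin N → Fin q → Vec (Fin q) (suc n)) λ T →
    (∀ t → IsTransversal f (T t)) × (∀ t u → SameSet (T t) (T u) → t ≡ u)

-- Proper representation of an n-ary quasigroup f, n = suc m:
-- x₀ = f(x₁,…,xₙ) ⇔ h₁(x_{π 0},…,x_{π (n-2)}) = h₂(x_{π (n-1)}, x_{π n}).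
-- (For m = 1, h₁ is a unary quasigroup, i.e. a permutation.)
record ProperRepresentation {q m : ℕ} (f : Op q (suc m)) : Set where
  field
    π   : Permutation (m + 2) (suc (suc m))
    h₁  : Op q m
    h₂  : Op q 2
    h₁-quasigroup : IsQuasigroup h₁
    h₁-cr         : m ≡ 1 ⊎ CompletelyReducible m h₁
    h₂-quasigroup : IsQuasigroup h₂
    represents    : ∀ (x : Vec (Fin q) (suc (suc m))) →
      Graph f x ⇔
      (h₁ (tabulate λ i → lookup x (π ⟨$⟩ʳ (i ↑ˡ 2)))
         ≡ h₂ (tabulate λ j → lookup x (π ⟨$⟩ʳ (m ↑ʳ j))))

-- Call a family of q vectors of Σ_q^{n+1} in the graph of f a partial transversal for a pattern if
-- some coordinates are fixed to constants and the family is injective in the remaining free ones.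
-- By induction along the decompositions x₀ = f(x) ⇔ g(…) = h(…) one proves: with 2(k+1) free coordinates,
-- f has at least (q·q!)^k distinct partial transversals. The free coordinates split over the blocks of g and h.
-- If both blocks receive an odd number, the linking variable is left free on both sides and the
-- partial transversals of g and h are matched by the value of the link. If both receive an even,
-- nonzero number, the link is fixed to each of the q values d and the two sides are paired along any
-- of the q! permutations of Σ_q; this is the source of the factor q·q!. If one block is entirely fixed,
-- the other block alone carries the count. For odd n all n+1 coordinates are free; for even n a
-- proper representation glues the all-free partial transversals of h₁ to the given transversal of h₂.

module Submission where

open import Defs
open import Data.Nat using (ℕ; zero; suc; _+_; _*_; _^_; _!; _≤_; _∸_; _%_; ⌊_/2⌋; s≤s; z≤n)
open import Data.Nat.Properties
  using (+-0-commutativeMonoid; n≤1+n; +-mono-≤; +-suc; +-assoc; suc-injective; 1+n≢n; +-identityʳ; *-identityʳ;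
         ^-distribˡ-+-*; ≤-trans; <-irrefl; n≡⌊n+n/2⌋; n≡⌈n+n/2⌉)
open import Data.Nat.DivMod using (%-pred-≡0)
open import Data.Nat.Tactic.RingSolver using (solve-∀)
open import Algebra.Properties.CommutativeMonoid.Sum +-0-commutativeMonoid using (sum; sum-permute; sum-cong-≗)
open import Data.Fin using (Fin; zero; suc; _↑ˡ_; _↑ʳ_; combine; remQuot; punchOut)
open import Data.Fin.Properties using (splitAt-↑ˡ; splitAt-↑ʳ; combine-remQuot; punchOut-injective; injective⇒≤; any?; +↔⊎)
  renaming (_≟_ to _≟ᶠ_; suc-injective to fsuc-injective)
open import Data.Fin.Permutation
  using (Permutation; Permutation′; _⟨$⟩ʳ_; _⟨$⟩ˡ_; inverseˡ; inverseʳ; permutation; _≈_; id; flip; lift₀; transpose; _∘ₚ_)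
open import Data.Vec using (Vec; []; _∷_; head; tail; lookup; tabulate; replicate; map; _[_]≔_)
open import Data.Vec.Properties using (lookup∘tabulate; tabulate∘lookup; tabulate-cong; lookup-replicate; lookup-map)
open import Data.Maybe using (Maybe; just; nothing)
open import Data.Product using (Σ; ∃-syntax; _×_; _,_; proj₁; proj₂; map₂; uncurry)
open import Data.Product.Properties using (×-≡,≡→≡)
open import Data.Sum using (_⊎_; inj₁; inj₂; [_,_]′)
open import Data.Sum.Algebra using (⊎-comm)
open import Data.Empty using (⊥; ⊥-elim)
open import Function using (_∘_; _↔_; Inverse; Injective)
open import Function.Bundles using (_⇔_; Equivalence; mk⇔)
open import Function.Construct.Composition using (_↔-∘_)
open import Function.Construct.Symmetry using (↔-sym)
open import Relation.Nullary using (yes; no)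
open import Relation.Binary.PropositionalEquality

double-injective : ∀ m n → m + m ≡ n + n → m ≡ n
double-injective m n e = trans (n≡⌊n+n/2⌋ m) (trans (cong ⌊_/2⌋ e) (sym (n≡⌊n+n/2⌋ n)))

double≢suc-double : ∀ m n → m + m ≢ suc (n + n)
double≢suc-double m n e with trans (n≡⌊n+n/2⌋ m) (trans (cong ⌊_/2⌋ e) (sym (n≡⌈n+n/2⌉ n)))
... | refl = 1+n≢n (sym e)

data Half (n : ℕ) : Set where
  even : ∀ k → n ≡ k + k → Half n
  odd  : ∀ k → n ≡ suc (k + k) → Half n

half : ∀ n → Half n
half zero = even 0 refl
half (suc n) with half n
... | even k e = odd k (cong suc e)
... | odd k e = even (suc k) (cong suc (trans e (sym (+-suc k k))))

%2≡1⇒odd : ∀ n → n % 2 ≡ 1 → ∃[ k ] n ≡ suc (k + k)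
%2≡1⇒odd (suc zero) _ = 0 , refl
%2≡1⇒odd (suc (suc n)) e with %2≡1⇒odd n e
... | k , refl = suc k , cong suc (sym (+-suc (suc k) k))

data Halves (L R k : ℕ) : Set where
  odd-odd     : ∀ r s → L ≡ suc (r + r) → R ≡ suc (s + s) → k ≡ r + s → Halves L R k
  fixed-left  : L ≡ 0 → R ≡ suc k + suc k → Halves L R k
  fixed-right : R ≡ 0 → L ≡ suc k + suc k → Halves L R k
  even-even   : ∀ r s → L ≡ suc r + suc r → R ≡ suc s + suc s → k ≡ suc (r + s) → Halves L R k

halves : ∀ L R k → L + R ≡ suc k + suc k → Halves L R k
halves L R k e with half L | half R
... | odd r refl | odd s refl =
  odd-odd r s refl refl (suc-injective (double-injective (suc k) (suc (r + s)) (trans (sym e) (lemma r s))))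
  where
  lemma : ∀ r s → suc (r + r) + suc (s + s) ≡ suc (r + s) + suc (r + s)
  lemma = solve-∀
... | even r refl | odd s refl = ⊥-elim (double≢suc-double (suc k) (r + s) (trans (sym e) (lemma r s)))
  where
  lemma : ∀ r s → (r + r) + suc (s + s) ≡ suc ((r + s) + (r + s))
  lemma = solve-∀
... | odd r refl | even s refl = ⊥-elim (double≢suc-double (suc k) (r + s) (trans (sym e) (lemma r s)))
  where
  lemma : ∀ r s → suc (r + r) + (s + s) ≡ suc ((r + s) + (r + s))
  lemma = solve-∀
... | even r refl | even s refl = even-halves r s (double-injective (r + s) (suc k) (trans (sym (lemma r s)) e))
  where
  lemma : ∀ r s → (r + r) + (s + s) ≡ (r + s) + (r + s)
  lemma = solve-∀
  even-halves : ∀ r s → r + s ≡ suc k → Halves (r + r) (s + s) k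
  even-halves zero     s        refl = fixed-left refl refl
  even-halves (suc r′) zero     e    = fixed-right refl (cong (λ x → x + x) (trans (sym (+-identityʳ (suc r′))) e))
  even-halves (suc r′) (suc s′) e    = even-even r′ s′ refl refl (trans (sym (suc-injective e)) (+-suc r′ s′))

injective⇒surjective : ∀ {n} {f : Fin n → Fin n} → Injective _≡_ _≡_ f → ∀ y → ∃[ x ] f x ≡ y
injective⇒surjective {n} {f} inj y with any? (λ x → f x ≟ᶠ y)
... | yes hit = hit
injective⇒surjective {suc n} {f} inj y | no miss = ⊥-elim (<-irrefl refl (injective⇒≤ avoid-y-injective))
  where
  avoid-y : Fin (suc n) → Fin n
  avoid-y x = punchOut {i = y} {j = f x} (λ e → miss (x , sym e))
  avoid-y-injective : Injective _≡_ _≡_ avoid-y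
  avoid-y-injective {x} {x′} e = inj (punchOut-injective (λ e → miss (x , sym e)) (λ e → miss (x′ , sym e)) e)

injective⇒permutation : ∀ {n} {f : Fin n → Fin n} → Injective _≡_ _≡_ f → Permutation′ n
injective⇒permutation {f = f} inj = permutation f (proj₁ ∘ surj) (proj₂ ∘ surj) (λ x → inj (proj₂ (surj (f x))))
  where surj = injective⇒surjective inj

⟨$⟩ʳ-injective : ∀ {m n} (π : Permutation m n) → Injective _≡_ _≡_ (π ⟨$⟩ʳ_)
⟨$⟩ʳ-injective π {x} {y} e = trans (sym (inverseˡ π)) (trans (cong (π ⟨$⟩ˡ_) e) (inverseˡ π))

uncurryFin : ∀ {m n} {A : Set} → (Fin m → Fin n → A) → Fin (m * n) → A
uncurryFin {m} {n} F t = uncurry F (remQuot {m} n t)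

uncurryFin-∀ : ∀ {m n} {A : Set} (P : A → Set) (F : Fin m → Fin n → A) →
  (∀ i j → P (F i j)) → ∀ t → P (uncurryFin F t)
uncurryFin-∀ {m} {n} P F p t = p (proj₁ (remQuot {m} n t)) (proj₂ (remQuot {m} n t))

remQuot-injective : ∀ {m} n {s t : Fin (m * n)} → remQuot {m} n s ≡ remQuot n t → s ≡ t
remQuot-injective {m} n {s} {t} e = begin
  s                                  ≡⟨ combine-remQuot {m} n s ⟨
  uncurry combine (remQuot {m} n s)  ≡⟨ cong (uncurry combine) e ⟩
  uncurry combine (remQuot {m} n t)  ≡⟨ combine-remQuot {m} n t ⟩
  t                                  ∎
  where open ≡-Reasoning

uncurryFin-injective : ∀ {m n} {A : Set} (_∼_ : A → A → Set) (F : Fin m → Fin n → A) →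
  (∀ {i j i′ j′} → F i j ∼ F i′ j′ → i ≡ i′ × j ≡ j′) →
  ∀ {t u} → uncurryFin F t ∼ uncurryFin F u → t ≡ u
uncurryFin-injective {m} {n} _ _ split e = remQuot-injective {m} n (×-≡,≡→≡ (split e))

-- Index (j, t) lists the permutation acting as the t-th permutation of S_{n-1} on 1..n and then swapping 0 with j.
allPermutations : ∀ n → Fin (n !) → Permutation′ n
allPermutations zero    _ = id
allPermutations (suc n) = uncurryFin λ j t → lift₀ (allPermutations n t) ∘ₚ transpose zero j

allPermutations-injective : ∀ n {s t} → allPermutations n s ≈ allPermutations n t → s ≡ t
allPermutations-injective zero {zero} {zero} _ = refl
allPermutations-injective (suc n) = uncurryFin-injective _≈_ (λ j t → lift₀ (allPermutations n t) ∘ₚ transpose zero j) components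
  where
  components : ∀ {j t j′ t′} →
    lift₀ (allPermutations n t) ∘ₚ transpose zero j ≈ lift₀ (allPermutations n t′) ∘ₚ transpose zero j′ →
    j ≡ j′ × t ≡ t′
  components {j} e with e zero
  ... | refl = refl , allPermutations-injective n (λ i → fsuc-injective (⟨$⟩ʳ-injective (transpose zero j) (e (suc i))))

sum-splitAt : ∀ a {b} (f : Fin (a + b) → ℕ) → sum f ≡ sum (f ∘ (_↑ˡ b)) + sum (f ∘ (a ↑ʳ_))
sum-splitAt zero    f = refl
sum-splitAt (suc a) f = trans (cong (f zero +_) (sum-splitAt a (f ∘ suc))) (sym (+-assoc (f zero) _ _))

Splitting : ℕ → ℕ → ℕ → Set
Splitting N a b = Fin N ↔ (Fin a ⊎ Fin b)

fromPermutation : ∀ {N a b} → Permutation (a + b) N → Splitting N a b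
fromPermutation {a = a} {b} σ = +↔⊎ {a} {b} ↔-∘ ↔-sym σ

swap : ∀ {N a b} → Splitting N a b → Splitting N b a
swap S = ⊎-comm _ _ ↔-∘ S

module SplittingOps {N a b} (S : Splitting N a b) where
  open Inverse S using (to; from; strictlyInverseˡ; strictlyInverseʳ)

  ιˡ : Fin a → Fin N
  ιˡ i = from (inj₁ i)

  ιʳ : Fin b → Fin N
  ιʳ j = from (inj₂ j)

  left : ∀ {A : Set} → Vec A N → Vec A a
  left x = tabulate λ i → lookup x (ιˡ i)

  right : ∀ {A : Set} → Vec A N → Vec A b
  right x = tabulate λ j → lookup x (ιʳ j)

  merge : ∀ {A : Set} → Vec A a → Vec A b → Vec A N
  merge u w = tabulate λ k → [ lookup u , lookup w ]′ (to k)

  ι-cases : ∀ k → (∃[ i ] ιˡ i ≡ k) ⊎ (∃[ j ] ιʳ j ≡ k)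
  ι-cases k with to k | strictlyInverseʳ k
  ... | inj₁ i | e = inj₁ (i , e)
  ... | inj₂ j | e = inj₂ (j , e)

  module _ {A : Set} (u : Vec A a) (w : Vec A b) where
    lookup-merge-ιˡ : ∀ i → lookup (merge u w) (ιˡ i) ≡ lookup u i
    lookup-merge-ιˡ i = trans (lookup∘tabulate _ (ιˡ i)) (cong [ lookup u , lookup w ]′ (strictlyInverseˡ (inj₁ i)))

    lookup-merge-ιʳ : ∀ j → lookup (merge u w) (ιʳ j) ≡ lookup w j
    lookup-merge-ιʳ j = trans (lookup∘tabulate _ (ιʳ j)) (cong [ lookup u , lookup w ]′ (strictlyInverseˡ (inj₂ j)))

    left-merge : left (merge u w) ≡ u
    left-merge = trans (tabulate-cong lookup-merge-ιˡ) (tabulate∘lookup u)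

    right-merge : right (merge u w) ≡ w
    right-merge = trans (tabulate-cong lookup-merge-ιʳ) (tabulate∘lookup w)

  merge-injective : ∀ {A : Set} {u u′ : Vec A a} {w w′ : Vec A b} → merge u w ≡ merge u′ w′ → u ≡ u′ × w ≡ w′
  merge-injective {u = u} {u′} {w} {w′} e =
    trans (sym (left-merge u w)) (trans (cong left e) (left-merge u′ w′)) ,
    trans (sym (right-merge u w)) (trans (cong right e) (right-merge u′ w′))

  asPermutation : Permutation (a + b) N
  asPermutation = ↔-sym S ↔-∘ +↔⊎

  left-replicate : ∀ {A : Set} (x : A) → left (replicate N x) ≡ replicate a x
  left-replicate x = trans (tabulate-cong λ i → trans (lookup-replicate (ιˡ i) x) (sym (lookup-replicate i x)))
                           (tabulate∘lookup (replicate a x))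

  right-replicate : ∀ {A : Set} (x : A) → right (replicate N x) ≡ replicate b x
  right-replicate x = trans (tabulate-cong λ j → trans (lookup-replicate (ιʳ j) x) (sym (lookup-replicate j x)))
                            (tabulate∘lookup (replicate b x))

module _ {q : ℕ} where

  -- A pattern prescribes for each coordinate of a family of q vectors either that the family takes
  -- pairwise distinct values there (nothing) or that it is constantly v there (just v).
  Pattern : ℕ → Set
  Pattern = Vec (Maybe (Fin q))

  free : Maybe (Fin q) → ℕ
  free nothing  = 1
  free (just _) = 0

  #free : ∀ {n} → Pattern n → ℕ
  #free c = sum (free ∘ lookup c)

  #free≤length : ∀ {n} (c : Pattern n) → #free c ≤ n
  #free≤length []             = z≤n
  #free≤length (nothing ∷ c)  = s≤s (#free≤length c)
  #free≤length (just _ ∷ c)   = ≤-trans (#free≤length c) (n≤1+n _)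

  #free≡0⇒fixed : ∀ {n} (c : Pattern n) → #free c ≡ 0 → ∃[ u ] c ≡ map just u
  #free≡0⇒fixed []           _ = [] , refl
  #free≡0⇒fixed (just v ∷ c) e with #free≡0⇒fixed c e
  ... | u , refl = v ∷ u , refl

  #free≢0⇒free : ∀ {n} (c : Pattern n) {k} → #free c ≡ suc k → ∃[ i ] lookup c i ≡ nothing
  #free≢0⇒free (nothing ∷ c) _ = zero , refl
  #free≢0⇒free (just _ ∷ c)  e with #free≢0⇒free c e
  ... | i , e′ = suc i , e′

  module _ {N a b} (S : Splitting N a b) where
    open SplittingOps S

    #free-split : (c : Pattern N) → #free c ≡ #free (left c) + #free (right c)
    #free-split c = begin
      sum (free ∘ lookup c)                                    ≡⟨ sum-permute (free ∘ lookup c) asPermutation ⟩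
      sum (free ∘ lookup c ∘ (asPermutation ⟨$⟩ʳ_))            ≡⟨ sum-splitAt a _ ⟩
      sum (free ∘ lookup c ∘ (asPermutation ⟨$⟩ʳ_) ∘ (_↑ˡ b))
        + sum (free ∘ lookup c ∘ (asPermutation ⟨$⟩ʳ_) ∘ (a ↑ʳ_))
                                                               ≡⟨ cong₂ _+_ (sum-cong-≗ onLeft) (sum-cong-≗ onRight) ⟩
      #free (left c) + #free (right c)                         ∎
      where
      open ≡-Reasoning
      onLeft : ∀ i → free (lookup c (asPermutation ⟨$⟩ʳ (i ↑ˡ b))) ≡ free (lookup (left c) i)
      onLeft i = cong free (trans (cong (lookup c ∘ Inverse.from S) (splitAt-↑ˡ a i b)) (sym (lookup∘tabulate _ i)))
      onRight : ∀ j → free (lookup c (asPermutation ⟨$⟩ʳ (a ↑ʳ j))) ≡ free (lookup (right c) j)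
      onRight j = cong free (trans (cong (lookup c ∘ Inverse.from S) (splitAt-↑ʳ a b j)) (sym (lookup∘tabulate _ j)))

  Family : ℕ → Set
  Family n = Fin q → Vec (Fin q) n

  Column : Maybe (Fin q) → (Fin q → Fin q) → Set
  Column nothing  col = Injective _≡_ _≡_ col
  Column (just v) col = ∀ i → col i ≡ v

  column-transport : ∀ {m m′ col col′} → m ≡ m′ → (∀ i → col i ≡ col′ i) → Column m col → Column m′ col′
  column-transport {nothing} refl e inj = inj ∘ λ e′ → trans (e _) (trans e′ (sym (e _)))
  column-transport {just v}  refl e fixed i = trans (sym (e i)) (fixed i)

  column-reindex : ∀ {m col} {ρ : Fin q → Fin q} → Injective _≡_ _≡_ ρ → Column m col → Column m (col ∘ ρ)
  column-reindex {nothing} ρ-inj inj   = ρ-inj ∘ inj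
  column-reindex {just v}  {ρ = ρ} _ fixed = λ i → fixed (ρ i)

  Fits : ∀ {n} → Pattern n → Family n → Set
  Fits c α = ∀ k → Column (lookup c k) (λ i → lookup (α i) k)

  fits-tail : ∀ {n m} {c : Pattern n} {α : Family (suc n)} → Fits (m ∷ c) α → Fits c (tail ∘ α)
  fits-tail {α = α} fits k = column-transport refl (λ i → lookup-tail (α i) k) (fits (suc k))
    where
    lookup-tail : ∀ {n} (v : Vec (Fin q) (suc n)) k → lookup v (suc k) ≡ lookup (tail v) k
    lookup-tail (_ ∷ _) _ = refl

  fits-constant : ∀ {n} (u : Vec (Fin q) n) → Fits (map just u) (λ _ → u)
  fits-constant u k = column-transport (sym (lookup-map k just u)) (λ _ → refl) λ _ → refl

  record PartialTransversal {n} (f : Op q n) (c : Pattern (suc n)) (α : Family (suc n)) : Set where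
    field
      inGraph : ∀ i → Graph f (α i)
      fits    : Fits c α

  open PartialTransversal

  free⇒injective : ∀ {n} {f : Op q n} {c α} → PartialTransversal f c α → ∀ {k} → lookup c k ≡ nothing → Injective _≡_ _≡_ α
  free⇒injective P {k} k-free e = column-transport k-free (λ _ → refl) (fits P k) (cong (λ v → lookup v k) e)

  infix 4 _⊆_
  _⊆_ : ∀ {n} → Family n → Family n → Set
  α ⊆ β = ∀ i → ∃[ j ] α i ≡ β j

  ⊆-trans : ∀ {n} {α β γ : Family n} → α ⊆ β → β ⊆ γ → α ⊆ γ
  ⊆-trans α⊆β β⊆γ i with α⊆β i
  ... | j , e with β⊆γ j
  ...   | l , e′ = l , trans e e′

  record AtLeastPartial {n} (f : Op q n) (c : Pattern (suc n)) (M : ℕ) : Set where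
    field
      family   : Fin M → Family (suc n)
      partial  : ∀ t → PartialTransversal f c (family t)
      distinct : ∀ {t u} → family t ⊆ family u → t ≡ u

  open AtLeastPartial

  module _ (π : Permutation′ q) where
    permute-⊆ : ∀ {n} (α : Family n) → α ∘ (π ⟨$⟩ʳ_) ⊆ α
    permute-⊆ α i = π ⟨$⟩ʳ i , refl

    ⊆-permute : ∀ {n} (α : Family n) → α ⊆ α ∘ (π ⟨$⟩ʳ_)
    ⊆-permute α i = π ⟨$⟩ˡ i , cong α (sym (inverseʳ π))

    partial-permute : ∀ {n} {f : Op q n} {c α} → PartialTransversal f c α → PartialTransversal f c (α ∘ (π ⟨$⟩ʳ_))
    partial-permute P = record
      { inGraph = inGraph P ∘ (π ⟨$⟩ʳ_)
      ; fits    = λ k → column-reindex (⟨$⟩ʳ-injective π) (fits P k)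
      }

  atLeastPartial-× : ∀ {n} {f : Op q n} {c M₁ M₂} (F : Fin M₁ → Fin M₂ → Family (suc n)) →
    (∀ i j → PartialTransversal f c (F i j)) → (∀ {i j i′ j′} → F i j ⊆ F i′ j′ → i ≡ i′ × j ≡ j′) →
    AtLeastPartial f c (M₁ * M₂)
  atLeastPartial-× F partialF split = record
    { family   = uncurryFin F
    ; partial  = uncurryFin-∀ (PartialTransversal _ _) F partialF
    ; distinct = uncurryFin-injective _⊆_ F split
    }

  module _ {n} (α : Family (suc n)) (heads-injective : Injective _≡_ _≡_ (λ i → lookup (α i) zero)) where
    byHead : Permutation′ q
    byHead = flip (injective⇒permutation heads-injective)

    lookup-byHead : ∀ i → lookup (α (byHead ⟨$⟩ʳ i)) zero ≡ i
    lookup-byHead i = inverseʳ (injective⇒permutation heads-injective)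

  graph-tail-injective : ∀ {n} {f : Op q n} {u v} → Graph f u → Graph f v → tail u ≡ tail v → u ≡ v
  graph-tail-injective {u = x ∷ xs} {y ∷ .xs} x≡fxs y≡fxs refl = cong (_∷ xs) (trans x≡fxs (sym y≡fxs))

  module Glue {n a b} {f : Op q n} {g : Op q a} {h : Op q b} (S : Splitting (suc n) a b)
    (composed : ∀ x → Graph f x ⇔ (g (SplittingOps.left S x) ≡ h (SplittingOps.right S x))) where
    open SplittingOps S

    glue : Family (suc a) → Family (suc b) → Family (suc n)
    glue α β i = merge (tail (α i)) (tail (β i))

    glue-partial : ∀ {c l r α β} → PartialTransversal g (l ∷ left c) α → PartialTransversal h (r ∷ right c) β →
      (∀ i → lookup (α i) zero ≡ lookup (β i) zero) → PartialTransversal f c (glue α β)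
    glue-partial {c} {α = α} {β} Pα Pβ same-link = record { inGraph = inGraph′ ; fits = fits′ }
      where
      head≡lookup-zero : ∀ {m} (v : Vec (Fin q) (suc m)) → head v ≡ lookup v zero
      head≡lookup-zero (_ ∷ _) = refl

      inGraph′ : ∀ i → Graph f (glue α β i)
      inGraph′ i = Equivalence.from (composed (glue α β i)) (begin
        g (left (glue α β i))   ≡⟨ cong g (left-merge (tail (α i)) (tail (β i))) ⟩
        g (tail (α i))          ≡⟨ inGraph Pα i ⟨
        head (α i)              ≡⟨ trans (head≡lookup-zero (α i)) (trans (same-link i) (sym (head≡lookup-zero (β i)))) ⟩
        head (β i)              ≡⟨ inGraph Pβ i ⟩
        h (tail (β i))          ≡⟨ cong h (right-merge (tail (α i)) (tail (β i))) ⟨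
        h (right (glue α β i))  ∎)
        where open ≡-Reasoning

      fits′ : Fits c (glue α β)
      fits′ k with ι-cases k
      ... | inj₁ (i , refl) = column-transport (lookup∘tabulate (lookup c ∘ ιˡ) i)
                                (λ t → sym (lookup-merge-ιˡ (tail (α t)) (tail (β t)) i)) (fits-tail {α = α} (fits Pα) i)
      ... | inj₂ (j , refl) = column-transport (lookup∘tabulate (lookup c ∘ ιʳ) j)
                                (λ t → sym (lookup-merge-ιʳ (tail (α t)) (tail (β t)) j)) (fits-tail {α = β} (fits Pβ) j)

    glue-⊆ : ∀ {cα cα′ cβ cβ′ α α′ β β′} →
      PartialTransversal g cα α → PartialTransversal g cα′ α′ → PartialTransversal h cβ β → PartialTransversal h cβ′ β′ →
      glue α β ⊆ glue α′ β′ → ∀ i → ∃[ j ] α i ≡ α′ j × β i ≡ β′ j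
    glue-⊆ {α = α} {α′} {β} {β′} Pα Pα′ Pβ Pβ′ incl i with incl i
    ... | j , e with merge-injective {u = tail (α i)} {tail (α′ j)} {tail (β i)} {tail (β′ j)} e
    ...   | eα , eβ = j , graph-tail-injective {f = g} (inGraph Pα i) (inGraph Pα′ j) eα
                        , graph-tail-injective {f = h} (inGraph Pβ i) (inGraph Pβ′ j) eβ

    -- Both blocks leave the linking coordinate free: match their members by the link value.
    glue-linked : ∀ {c M₁ M₂} → AtLeastPartial g (nothing ∷ left c) M₁ → AtLeastPartial h (nothing ∷ right c) M₂ →
      AtLeastPartial f c (M₁ * M₂)
    glue-linked {c} {M₁} {M₂} A B = atLeastPartial-× glued partial-glued split
      where
      sortA : ∀ t → Permutation′ q
      sortA t = byHead (family A t) (fits (partial A t) zero)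
      sortB : ∀ t → Permutation′ q
      sortB t = byHead (family B t) (fits (partial B t) zero)

      sortedA : ∀ t → PartialTransversal g (nothing ∷ left c) (family A t ∘ (sortA t ⟨$⟩ʳ_))
      sortedA t = partial-permute (sortA t) (partial A t)
      sortedB : ∀ t → PartialTransversal h (nothing ∷ right c) (family B t ∘ (sortB t ⟨$⟩ʳ_))
      sortedB t = partial-permute (sortB t) (partial B t)

      glued : Fin M₁ → Fin M₂ → Family (suc n)
      glued t₁ t₂ = glue (family A t₁ ∘ (sortA t₁ ⟨$⟩ʳ_)) (family B t₂ ∘ (sortB t₂ ⟨$⟩ʳ_))

      partial-glued : ∀ t₁ t₂ → PartialTransversal f c (glued t₁ t₂)
      partial-glued t₁ t₂ = glue-partial (sortedA t₁) (sortedB t₂)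
        λ i → trans (lookup-byHead (family A t₁) (fits (partial A t₁) zero) i)
                    (sym (lookup-byHead (family B t₂) (fits (partial B t₂) zero) i))

      split : ∀ {t₁ t₂ u₁ u₂} → glued t₁ t₂ ⊆ glued u₁ u₂ → t₁ ≡ u₁ × t₂ ≡ u₂
      split {t₁} {t₂} {u₁} {u₂} incl =
        distinct A (⊆-trans (⊆-permute (sortA t₁) _) (⊆-trans (map₂ proj₁ ∘ pairs) (permute-⊆ (sortA u₁) _))) ,
        distinct B (⊆-trans (⊆-permute (sortB t₂) _) (⊆-trans (map₂ proj₂ ∘ pairs) (permute-⊆ (sortB u₂) _)))
        where
        pairs = glue-⊆ (sortedA t₁) (sortedA u₁) (sortedB t₂) (sortedB u₂) incl

    -- The link is fixed to d on both sides, so members may be matched along any permutation of Fin q;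
    -- a free coordinate on each side makes the permutation recoverable from the glued transversal.
    glue-unlinked : ∀ {c M₁ M₂} → (∀ d → AtLeastPartial g (just d ∷ left c) M₁) → (∀ d → AtLeastPartial h (just d ∷ right c) M₂) →
      ∀ {iˡ iʳ} → lookup (left c) iˡ ≡ nothing → lookup (right c) iʳ ≡ nothing →
      AtLeastPartial f c ((q * q !) * (M₁ * M₂))
    glue-unlinked {c} {M₁} {M₂} A B {iˡ} {iʳ} freeˡ freeʳ = atLeastPartial-× glued partial-glued split
      where
      π : Fin (q !) → Permutation′ q
      π = allPermutations q

      glued′ : Fin q → Fin (q !) → Fin M₁ → Fin M₂ → Family (suc n)
      glued′ d p t₁ t₂ = glue (family (A d) t₁) (family (B d) t₂ ∘ (π p ⟨$⟩ʳ_))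

      glued : Fin (q * q !) → Fin (M₁ * M₂) → Family (suc n)
      glued = uncurryFin λ d p → uncurryFin (glued′ d p)

      permutedB : ∀ d p t → PartialTransversal h (just d ∷ right c) (family (B d) t ∘ (π p ⟨$⟩ʳ_))
      permutedB d p t = partial-permute (π p) (partial (B d) t)

      partial-glued′ : ∀ d p t₁ t₂ → PartialTransversal f c (glued′ d p t₁ t₂)
      partial-glued′ d p t₁ t₂ = glue-partial (partial (A d) t₁) (permutedB d p t₂)
        (λ i → trans (fits (partial (A d) t₁) zero i) (sym (fits (permutedB d p t₂) zero i)))

      partial-glued : ∀ s t → PartialTransversal f c (glued s t)
      partial-glued = uncurryFin-∀ (λ G → ∀ t → PartialTransversal f c (G t)) (λ d p → uncurryFin (glued′ d p))
        λ d p → uncurryFin-∀ (PartialTransversal f c) (glued′ d p) (partial-glued′ d p)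

      pairs : ∀ {d p t₁ t₂ d′ p′ u₁ u₂} → glued′ d p t₁ t₂ ⊆ glued′ d′ p′ u₁ u₂ → ∀ i →
        ∃[ j ] family (A d) t₁ i ≡ family (A d′) u₁ j × family (B d) t₂ (π p ⟨$⟩ʳ i) ≡ family (B d′) u₂ (π p′ ⟨$⟩ʳ j)
      pairs {d} {p} {t₁} {t₂} {d′} {p′} {u₁} {u₂} =
        glue-⊆ (partial (A d) t₁) (partial (A d′) u₁) (permutedB d p t₂) (permutedB d′ p′ u₂)

      same-link : ∀ {d p t₁ t₂ d′ p′ u₁ u₂} → glued′ d p t₁ t₂ ⊆ glued′ d′ p′ u₁ u₂ → d ≡ d′
      same-link {d} {p} {t₁} {t₂} {d′} {p′} {u₁} {u₂} incl with pairs {d} {p} {t₁} {t₂} {d′} {p′} {u₁} {u₂} incl d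
      ... | j , e , _ = begin
        d                              ≡⟨ fits (partial (A d) t₁) zero d ⟨
        lookup (family (A d) t₁ d) zero   ≡⟨ cong (λ v → lookup v zero) e ⟩
        lookup (family (A d′) u₁ j) zero  ≡⟨ fits (partial (A d′) u₁) zero j ⟩
        d′                             ∎
        where open ≡-Reasoning

      same-members : ∀ {d p t₁ t₂ p′ u₁ u₂} → glued′ d p t₁ t₂ ⊆ glued′ d p′ u₁ u₂ → t₁ ≡ u₁ × t₂ ≡ u₂
      same-members {d} {p} {t₁} {t₂} {p′} {u₁} {u₂} incl =
        distinct (A d) (map₂ proj₁ ∘ pairs′) ,
        distinct (B d) (⊆-trans (⊆-permute (π p) (family (B d) t₂))
                       (⊆-trans (map₂ proj₂ ∘ pairs′) (permute-⊆ (π p′) (family (B d) u₂))))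
        where pairs′ = pairs {d} {p} {t₁} {t₂} {d} {p′} {u₁} {u₂} incl

      same-permutation : ∀ {d p t₁ t₂ p′} → glued′ d p t₁ t₂ ⊆ glued′ d p′ t₁ t₂ → p ≡ p′
      same-permutation {d} {p} {t₁} {t₂} {p′} incl = allPermutations-injective q same-values
        where
        same-values : π p ≈ π p′
        same-values i with pairs {d} {p} {t₁} {t₂} {d} {p′} {t₁} {t₂} incl i
        ... | j , eα , eβ with free⇒injective (partial (A d) t₁) {suc iˡ} freeˡ {i} {j} eα
        ...   | refl = free⇒injective (partial (B d) t₂) {suc iʳ} freeʳ eβ

      components : ∀ {d p t₁ t₂ d′ p′ u₁ u₂} → glued′ d p t₁ t₂ ⊆ glued′ d′ p′ u₁ u₂ →
        (d ≡ d′ × p ≡ p′) × (t₁ ≡ u₁ × t₂ ≡ u₂)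
      components {d} {p} {t₁} {t₂} {d′} {p′} {u₁} {u₂} incl
        with same-link {d} {p} {t₁} {t₂} {d′} {p′} {u₁} {u₂} incl
      ... | refl with same-members {d} {p} {t₁} {t₂} {p′} {u₁} {u₂} incl
      ...   | refl , refl = (refl , same-permutation {d} {p} {t₁} {t₂} {p′} incl) , (refl , refl)

      split : ∀ {s t s′ t′} → glued s t ⊆ glued s′ t′ → s ≡ s′ × t ≡ t′
      split incl with components incl
      ... | link , members = remQuot-injective (q !) (×-≡,≡→≡ link) , remQuot-injective M₂ (×-≡,≡→≡ members)

    glue-fixed-left : ∀ {c M u} → left c ≡ map just u → AtLeastPartial h (just (g u) ∷ right c) M → AtLeastPartial f c M
    glue-fixed-left {c} {M} {u} left-fixed B = record
      { family   = glued
      ; partial  = λ t → glue-partial constant (partial B t) (λ i → sym (fits (partial B t) zero i))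
      ; distinct = λ {t} {t′} incl → distinct B (map₂ proj₂ ∘ glue-⊆ constant constant (partial B t) (partial B t′) incl)
      }
      where
      glued : Fin M → Family (suc n)
      glued t = glue (λ _ → g u ∷ u) (family B t)

      constant : PartialTransversal g (just (g u) ∷ left c) (λ _ → g u ∷ u)
      constant = record
        { inGraph = λ _ → refl
        ; fits    = λ { zero _ → refl ; (suc k) → subst (λ c′ → Column (lookup c′ k) _) (sym left-fixed) (fits-constant u k) }
        }

  singleton : ∀ {n} {f : Op q n} {c α} → PartialTransversal f c α → AtLeastPartial f c 1
  singleton {α = α} P = record { family = λ _ → α ; partial = λ _ → P ; distinct = λ { {zero} {zero} _ → refl } }

  quasigroup-unique : ∀ {n} {f : Op q n} → IsQuasigroup f → ∀ k x {a a′} → Graph f (x [ k ]≔ a) → Graph f (x [ k ]≔ a′) → a ≡ a′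
  quasigroup-unique qf k x Ga Ga′ = trans (sym (proj₂ (proj₂ (qf k x)) Ga)) (proj₂ (proj₂ (qf k x)) Ga′)

  unary-base : ∀ {f : Op q 1} → IsQuasigroup f → AtLeastPartial f (nothing ∷ nothing ∷ []) 1
  unary-base {f} qf = singleton {α = α} record
    { inGraph = λ _ → refl
    ; fits    = λ { zero → quasigroup-unique {f = f} qf (suc zero) (α _) refl ; (suc zero) → λ e → e } }
    where
    α : Family 2
    α i = f (i ∷ []) ∷ i ∷ []

  binary-base : ∀ {f : Op q 2} → IsQuasigroup f → ∀ c → #free c ≡ 2 → AtLeastPartial f c 1
  binary-base {f} qf (just v ∷ nothing ∷ nothing ∷ []) _ = singleton {α = α} record
    { inGraph = λ i → proj₁ (proj₂ (solution i))
    ; fits    = λ { zero → λ _ → refl ; (suc zero) → λ e → e ; (suc (suc zero)) → second-injective } }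
    where
    solution : ∀ i → _
    solution i = qf (suc (suc zero)) (v ∷ i ∷ i ∷ [])
    α : Family 3
    α i = v ∷ i ∷ proj₁ (solution i) ∷ []
    second-injective : Injective _≡_ _≡_ (λ i → proj₁ (solution i))
    second-injective {i} {j} e = quasigroup-unique {f = f} qf (suc zero) (α i) (proj₁ (proj₂ (solution i)))
      (subst (λ z → Graph f (v ∷ j ∷ z ∷ [])) (sym e) (proj₁ (proj₂ (solution j))))
  binary-base {f} qf (nothing ∷ just v ∷ nothing ∷ []) _ = singleton {α = α} record
    { inGraph = λ _ → refl
    ; fits    = λ { zero → quasigroup-unique {f = f} qf (suc (suc zero)) (α _) refl ; (suc zero) → λ _ → refl ; (suc (suc zero)) → λ e → e } }
    where
    α : Family 3
    α i = f (v ∷ i ∷ []) ∷ v ∷ i ∷ []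
  binary-base {f} qf (nothing ∷ nothing ∷ just v ∷ []) _ = singleton {α = α} record
    { inGraph = λ _ → refl
    ; fits    = λ { zero → quasigroup-unique {f = f} qf (suc zero) (α _) refl ; (suc zero) → λ e → e ; (suc (suc zero)) → λ _ → refl } }
    where
    α : Family 3
    α i = f (i ∷ v ∷ []) ∷ i ∷ v ∷ []
  binary-base qf (just _  ∷ just _  ∷ just _  ∷ []) ()
  binary-base qf (just _  ∷ just _  ∷ nothing ∷ []) ()
  binary-base qf (just _  ∷ nothing ∷ just _  ∷ []) ()
  binary-base qf (nothing ∷ just _  ∷ just _  ∷ []) ()
  binary-base qf (nothing ∷ nothing ∷ nothing ∷ []) ()

  PartialTransversalBound : ∀ {n} → Op q n → Set
  PartialTransversalBound {n} f = ∀ (c : Pattern (suc n)) k → #free c ≡ suc k + suc k → AtLeastPartial f c ((q * q !) ^ k)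

  binary-bound : ∀ {f : Op q 2} → IsQuasigroup f → PartialTransversalBound f
  binary-bound qf c zero    e = binary-base qf c e
  binary-bound qf c (suc k) e = ⊥-elim (4≰3 (≤-trans 4≤ (subst (_≤ 3) e (#free≤length c))))
    where
    4≰3 : 4 ≤ 3 → ⊥
    4≰3 (s≤s (s≤s (s≤s ())))
    4≤ : 4 ≤ suc (suc k) + suc (suc k)
    4≤ = +-mono-≤ (s≤s (s≤s z≤n)) (s≤s (s≤s z≤n))

  module _ {n a b} {f : Op q n} {g : Op q a} {h : Op q b} (S : Splitting (suc n) a b)
    (composed : ∀ x → Graph f x ⇔ (g (SplittingOps.left S x) ≡ h (SplittingOps.right S x))) where
    open SplittingOps S
    open Glue {f = f} {g} {h} S composed
    open Glue {f = f} {h} {g} (swap S) (λ x → mk⇔ (sym ∘ Equivalence.to (composed x)) (Equivalence.from (composed x) ∘ sym))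
      using () renaming (glue-fixed-left to glue-fixed-right)

    composition-bound : PartialTransversalBound g → PartialTransversalBound h → PartialTransversalBound f
    composition-bound bound-g bound-h c k e with halves (#free (left c)) (#free (right c)) k (trans (sym (#free-split S c)) e)
    ... | odd-odd r s eˡ eʳ refl =
      subst (AtLeastPartial f c) (sym (^-distribˡ-+-* (q * q !) r s))
        (glue-linked (bound-g (nothing ∷ left c) r (linked eˡ)) (bound-h (nothing ∷ right c) s (linked eʳ)))
      where
      linked : ∀ {L r} → L ≡ suc (r + r) → suc L ≡ suc r + suc r
      linked {r = r} e = cong suc (trans e (sym (+-suc r r)))
    ... | fixed-left eˡ eʳ with #free≡0⇒fixed (left c) eˡ
    ...   | u , fixed = glue-fixed-left fixed (bound-h (just (g u) ∷ right c) k eʳ)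
    composition-bound bound-g bound-h c k e | fixed-right eʳ eˡ with #free≡0⇒fixed (right c) eʳ
    ...   | w , fixed = glue-fixed-right fixed (bound-g (just (h w) ∷ left c) k eˡ)
    composition-bound bound-g bound-h c k e | even-even r s eˡ eʳ refl =
      subst (AtLeastPartial f c) (cong (q * q ! *_) (sym (^-distribˡ-+-* (q * q !) r s)))
        (glue-unlinked (λ d → bound-g (just d ∷ left c) r eˡ) (λ d → bound-h (just d ∷ right c) s eʳ)
          (proj₂ (#free≢0⇒free (left c) eˡ)) (proj₂ (#free≢0⇒free (right c) eʳ)))

  completelyReducible-bound : ∀ {n} {f : Op q n} → CompletelyReducible n f → PartialTransversalBound f
  completelyReducible-bound (binary qf) = binary-bound qf
  completelyReducible-bound (compose _ _ _ _ crg crh (σ , composed)) =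
    composition-bound (fromPermutation σ) composed (completelyReducible-bound crg) (completelyReducible-bound crh)

  #free-allFree : ∀ n → #free (replicate n nothing) ≡ n
  #free-allFree zero    = refl
  #free-allFree (suc n) = cong suc (#free-allFree n)

  allFree-bound : ∀ {n} {f : Op q n} → PartialTransversalBound f → ∀ k → n ≡ suc (k + k) →
    AtLeastPartial f (replicate (suc n) nothing) ((q * q !) ^ k)
  allFree-bound bound k refl = bound (replicate _ nothing) k (trans (#free-allFree _) (cong suc (sym (+-suc k k))))

  unary-or-reducible-allFree : ∀ k {f : Op q (suc (k + k))} → IsQuasigroup f → suc (k + k) ≡ 1 ⊎ CompletelyReducible _ f →
    AtLeastPartial f (replicate (suc (suc (k + k))) nothing) ((q * q !) ^ k)
  unary-or-reducible-allFree zero    qf (inj₁ _)  = unary-base qf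
  unary-or-reducible-allFree (suc k) qf (inj₁ ())
  unary-or-reducible-allFree k       qf (inj₂ cr) = allFree-bound (completelyReducible-bound cr) k refl

  transversal⇒partial : ∀ {n} {f : Op q n} {α} → IsTransversal f α → PartialTransversal f (replicate (suc n) nothing) α
  transversal⇒partial (graph , latin) = record
    { inGraph = graph
    ; fits    = λ k → column-transport (sym (lookup-replicate k nothing)) (λ _ → refl) (latin _ _ k)
    }

  partial⇒transversal : ∀ {n} {f : Op q n} {α} → PartialTransversal f (replicate (suc n) nothing) α → IsTransversal f α
  partial⇒transversal P = inGraph P , λ i j k → column-transport (lookup-replicate k nothing) (λ _ → refl) (fits P k)

  atLeastTransversals : ∀ {n} {f : Op q n} {M} → AtLeastPartial f (replicate (suc n) nothing) M → AtLeastTransversals f M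
  atLeastTransversals A = family A , partial⇒transversal ∘ partial A , λ t u same →
    distinct A λ i → map₂ sym (Equivalence.to (same (family A t i)) (i , refl))

  properRepresentation-transversals : ∀ {k} {f : Op q (suc (suc (k + k)))} (P : ProperRepresentation f) →
    HasTransversal (ProperRepresentation.h₂ P) → AtLeastTransversals f ((q * q !) ^ k)
  properRepresentation-transversals {k} {f} P (α , transversal) =
    atLeastTransversals (subst (AtLeastPartial f allFree) (*-identityʳ _) (glue-linked h₁-partial h₂-partial))
    where
    open ProperRepresentation P
    S = fromPermutation π
    open SplittingOps S
    open Glue {f = f} {h₁} {h₂} S represents

    allFree : Pattern (suc (suc (suc (k + k))))
    allFree = replicate _ nothing

    h₁-partial : AtLeastPartial h₁ (nothing ∷ left allFree) ((q * q !) ^ k)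
    h₁-partial = subst (λ c → AtLeastPartial h₁ (nothing ∷ c) ((q * q !) ^ k)) (sym (left-replicate nothing))
      (unary-or-reducible-allFree k h₁-quasigroup h₁-cr)

    h₂-partial : AtLeastPartial h₂ (nothing ∷ right allFree) 1
    h₂-partial = subst (λ c → AtLeastPartial h₂ (nothing ∷ c) 1) (sym (right-replicate nothing))
      (singleton (transversal⇒partial {α = α} transversal))

  odd-arity-transversals : ∀ {n} {f : Op q n} → CompletelyReducible n f → n % 2 ≡ 1 →
    AtLeastTransversals f ((q * q !) ^ ⌊ n ∸ 1 /2⌋)
  odd-arity-transversals {n} cr n-odd with %2≡1⇒odd n n-odd
  ... | k , refl rewrite sym (n≡⌊n+n/2⌋ k) = atLeastTransversals (allFree-bound (completelyReducible-bound cr) k refl)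

  even-arity-transversals : ∀ {m} {f : Op q (suc m)} (P : ProperRepresentation f) → HasTransversal (ProperRepresentation.h₂ P) →
    suc m % 2 ≡ 0 → AtLeastTransversals f ((q * q !) ^ ⌊ m /2⌋)
  even-arity-transversals {m} P transversal suc-m-even with %2≡1⇒odd m (%-pred-≡0 {m} {2} suc-m-even)
  ... | k , refl rewrite sym (n≡⌈n+n/2⌉ k) = properRepresentation-transversals {k} P transversal

-- Part 2 does not use the complete reducibility of f: that of h₁ in the proper representation suffices.
theorem7 :
    (∀ {q n : ℕ} (f : Op q n) → CompletelyReducible n f → n % 2 ≡ 1 →
      AtLeastTransversals f ((q * q !) ^ ⌊ n ∸ 1 /2⌋))
    ×
    (∀ {q m : ℕ} (f : Op q (suc m)) → CompletelyReducible (suc m) f → suc m % 2 ≡ 0 →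
      (Σ (ProperRepresentation f) λ P → HasTransversal (ProperRepresentation.h₂ P)) →
      AtLeastTransversals f ((q * q !) ^ ⌊ m /2⌋))
theorem7 =
  (λ _ cr n-odd → odd-arity-transversals cr n-odd) ,
  (λ _ _ suc-m-even (P , transversal) → even-arity-transversals P transversal suc-m-even)
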